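{- For every positive integer $m$, the neighbourhood corona $K_3\star K_m$ is Class $1$, i.e. $\pi(K_3\star K_m)=|V(K_3\star K_m)|+1=3m+4$.
   Context: For a simple graph $G=(V,E)$, a configuration is a function $\phi:V\to\mathbb{N}\cup\{0\}$; its size is $\sum_{u\in V}\phi(u)$. A pebbling step from a vertex $u$ to a neighbour $v$ removes two pebbles from $u$ and adds one pebble to $v$. For a target $r$, $\phi$ is $r$-solvable if some sequence of pebbling steps places at least one pebble on $r$. $\pi(G,r)$ is the minimum positive integer $m$ such that every configuration of size $m$ is $r$-solvable, and $\pi(G)=\max_{r\in V}\pi(G,r)$. $G$ is Class $0$ if $\pi(G)=|V(G)|$ and Class $1$ if $\pi(G)=|V(G)|+1$. The neighbourhood corona $G\star H$ is obtained from one copy of $G$ and $|V(G)|$ copies of $H$ by joining every neighbour (in $G$) of the $i$-th vertex of $G$ to every vertex of the $i$-th copy of $H$. -}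

module Defs where

open import Data.Nat using (ℕ; zero; suc; _+_; _*_; _∸_; _≤_; _<_)
open import Data.Fin using (Fin)
open import Data.Nat.ListAction using (sum)
open import Data.List using (List; map; length; _++_; concatMap; allFin)
open import Data.Sum using (_⊎_; inj₁; inj₂)
open import Data.Product using (Σ; ∃; ∃-syntax; _×_; _,_)
open import Relation.Binary.PropositionalEquality using (_≡_; _≢_)
open import Relation.Binary.Construct.Closure.ReflexiveTransitive using (Star)
open import Relation.Nullary using (¬_)

-- A finite simple graph: a vertex type, an adjacency relation and an
-- explicit list enumerating every vertex exactly once.
record Graph : Set₁ where
  field
    V        : Set
    Adj      : V → V → Set
    vertices : List V

open Graph public

order : Graph → ℕ
order G = length (vertices G)

K : ℕ → Graph
K n = record { V = Fin n ; Adj = λ i j → i ≢ j ; vertices = allFin n }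

-- Neighbourhood corona G ⋆ H: vertices of G (inj₁ u) and, for each vertex i
-- of G, a copy of H (inj₂ (i , h)).  Every G-neighbour of i is joined to
-- every vertex of the i-th copy of H.
CoronaAdj : (G H : Graph) → V G ⊎ (V G × V H) → V G ⊎ (V G × V H) → Set
CoronaAdj G H (inj₁ u) (inj₁ v) = Adj G u v
CoronaAdj G H (inj₁ u) (inj₂ (i , h)) = Adj G u i
CoronaAdj G H (inj₂ (i , h)) (inj₁ u) = Adj G i u
CoronaAdj G H (inj₂ (i , h)) (inj₂ (j , h′)) = (i ≡ j) × Adj H h h′

_⋆_ : Graph → Graph → Graph
G ⋆ H = record
  { V = V G ⊎ (V G × V H)
  ; Adj = CoronaAdj G H
  ; vertices = map inj₁ (vertices G)
               ++ concatMap (λ i → map (λ h → inj₂ (i , h)) (vertices H)) (vertices G)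
  }

Config : Graph → Set
Config G = V G → ℕ

size : (G : Graph) → Config G → ℕ
size G φ = sum (map φ (vertices G))

Step : (G : Graph) → Config G → Config G → Set
Step G φ ψ = ∃[ u ] ∃[ v ] (Adj G u v × (ψ u + 2 ≡ φ u) × (ψ v ≡ φ v + 1)
               × (∀ w → w ≢ u → w ≢ v → ψ w ≡ φ w))

Solvable : (G : Graph) → Config G → V G → Set
Solvable G φ r = ∃[ ψ ] (Star (Step G) φ ψ × 1 ≤ ψ r)

AllSolvable : (G : Graph) → V G → ℕ → Set
AllSolvable G r m = ∀ (φ : Config G) → size G φ ≡ m → Solvable G φ r

IsRootedPebblingNumber : (G : Graph) → V G → ℕ → Set
IsRootedPebblingNumber G r p =
  (0 < p) × AllSolvable G r p × (∀ j → 0 < j → j < p → ¬ AllSolvable G r j)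

IsPebblingNumber : Graph → ℕ → Set
IsPebblingNumber G p =
  (∀ r → ∃[ q ] (IsRootedPebblingNumber G r q × q ≤ p))
  × (∃[ r ] IsRootedPebblingNumber G r p)

Class1 : Graph → Set
Class1 G = IsPebblingNumber G (order G + 1)

-- Write u a for the hubs (the vertices of K 3) and H a for the copies of K m, the copy H a
-- being joined to the two hubs other than u a.
--
-- A root r is reached from a neighbour holding two pebbles,
-- along a path x – w – r with two pebbles on x and one on w, or through a common neighbour w
-- of r receiving one pebble from each of two vertices; a copy adjacent to w carrying m + 3
-- pebbles always supplies such a pair (pigeonhole).  If no such strategy applies, possibly
-- after moving one pebble from H j onto u i, the pigeonhole principle bounds every part of
-- the configuration and the bounds add up to less than 3m + 3 pebbles for a hub root u i and
-- less than 3m + 4 for a root ρ in H i.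
--
-- Lower bounds: one pebble on every copy vertex except three on one vertex of H i (3m + 2
-- pebbles) cannot reach u i, and one pebble on every copy vertex except none on ρ and three on
-- the vertices of H j and H k at position ρ (3m + 3 pebbles) cannot reach ρ; every smaller
-- size is obtained by removing pebbles.  Both claims follow from invariants that hold below
-- these configurations and survive every pebbling step.  For u i: either no vertex has two
-- pebbles, or the hubs are empty and only one vertex of H i has two or three.  For ρ: the hubs
-- u j and u k never get two pebbles, so H i is never fed; this is kept by a potential
-- (`Capped`) counting what could still be gathered on each of them.

{-# OPTIONS --safe #-}
module Submission where

open import Defs
import Algebra.Properties.CommutativeMonoid.Sum as FinSum
open import Data.Fin using (Fin; zero; suc; punchIn)
open import Data.Fin.Patterns using (0F; 1F; 2F)
open import Data.Fin.Properties using (any?; punchInᵢ≢i) renaming (_≟_ to _≟ᶠ_)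
open import Data.List using (List; []; _∷_; map; _++_; concatMap; allFin; tabulate; length)
open import Data.List.Properties using (map-++; map-∘; map-tabulate)
open import Data.Nat using (ℕ; zero; suc; _+_; _*_; _∸_; _≤_; _<_; z≤n; s≤s; s≤s⁻¹; _≤?_)
open import Data.Nat.ListAction using (sum)
open import Data.Nat.ListAction.Properties using (sum-++)
open import Data.Nat.Properties
open import Algebra.Properties.CommutativeSemigroup +-commutativeSemigroup
  using (xy∙z≈xz∙y; x∙yz≈xz∙y)
open import Data.Nat.Tactic.RingSolver using (solve; solve-∀)
open import Data.Product using (∃-syntax; _×_; _,_; proj₁; proj₂)
open import Data.Sum as Sum using (_⊎_; inj₁; inj₂)
open import Data.Sum.Properties using (≡-dec)
import Data.Product.Properties as Product
open import Data.Vec.Functional using (removeAt)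
open import Function using (_∘_; id)
open import Function.Definitions using (Injective)
open import Relation.Binary.Construct.Closure.ReflexiveTransitive
  using (Star; fold; ε; _◅_)
open import Relation.Binary.Definitions using (DecidableEquality)
open import Relation.Binary.PropositionalEquality
open import Relation.Nullary using (¬_; yes; no; contradiction)

open FinSum +-0-commutativeMonoid using (sum-cong-≗; sum-remove) renaming (sum to ∑)

-- Arithmetic, finite sums and the pigeonhole principle

+-cancel-bounded : ∀ {x y b c} → y ≤ b → b + c ≤ y + x → c ≤ x
+-cancel-bounded {x} {y} {b} {c} y≤b b+c≤y+x =
  +-cancelˡ-≤ b c x (≤-trans b+c≤y+x (+-monoˡ-≤ x y≤b))

+-split : ∀ {j} a b → j ≤ a + b →
          ∃[ j₁ ] ∃[ j₂ ] j₁ ≤ a × j₂ ≤ b × j₁ + j₂ ≡ j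
+-split {j} a b j≤a+b with j ≤? a
... | yes j≤a = j , 0 , j≤a , z≤n , +-identityʳ j
... | no j≰a  =
  a , j ∸ a , ≤-refl , m≤n+o⇒m∸n≤o j a j≤a+b , m+[n∸m]≡n (<⇒≤ (≰⇒> j≰a))

sending⇒≰1 : ∀ {a b} → a + 2 ≡ b → ¬ b ≤ 1
sending⇒≰1 {a} refl = <⇒≱ (m≤n+m 2 a)

≤1-after-sending : ∀ {a b} → a + 2 ≡ b → b ≤ 3 → a ≤ 1
≤1-after-sending {a} refl b≤3 = +-cancelʳ-≤ 2 a 1 b≤3

∑-mono-≤ : ∀ {n} {f g : Fin n → ℕ} → (∀ x → f x ≤ g x) → ∑ f ≤ ∑ g
∑-mono-≤ {zero}  f≤g = z≤n
∑-mono-≤ {suc n} f≤g = +-mono-≤ (f≤g zero) (∑-mono-≤ (f≤g ∘ suc))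

∑-const : ∀ n c → ∑ {n} (λ _ → c) ≡ n * c
∑-const zero    c = refl
∑-const (suc n) c = cong (c +_) (∑-const n c)

∑-light : ∀ {n} (f : Fin n → ℕ) → (∀ x → f x ≤ 1) → ∑ f ≤ n
∑-light {n} f f≤1 =
  ≤-trans (∑-mono-≤ f≤1) (≤-reflexive (trans (∑-const n 1) (*-identityʳ n)))

pigeonhole : ∀ {n} (f : Fin n → ℕ) → suc n ≤ ∑ f → ∃[ x ] 2 ≤ f x
pigeonhole f n<∑f with any? (λ x → 2 ≤? f x)
... | yes heavy = heavy
... | no ¬heavy =
  contradiction n<∑f (≤⇒≯ (∑-light f (λ x → s≤s⁻¹ (≰⇒> (¬heavy ∘ (x ,_))))))

pigeonhole-except : ∀ {n} (f : Fin n → ℕ) z {c} → f z ≤ c → c + n ≤ ∑ f →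
                    ∃[ y ] y ≢ z × 2 ≤ f y
pigeonhole-except {suc n} f z fz≤c big
  with pigeonhole (removeAt f z)
                  (+-cancel-bounded fz≤c (≤-trans big (≤-reflexive (sum-remove f))))
... | y , heavy = punchIn z y , punchInᵢ≢i z y , heavy

pigeonhole₂ : ∀ {n} (f : Fin n → ℕ) → 3 + n ≤ ∑ f →
              (∃[ x ] 4 ≤ f x) ⊎ (∃[ x ] ∃[ y ] y ≢ x × 2 ≤ f x × 2 ≤ f y)
pigeonhole₂ {n} f big with pigeonhole f (≤-trans (m≤n+m (suc n) 2) big)
... | x , x-heavy with 4 ≤? f x
...   | yes x-very-heavy = inj₁ (x , x-very-heavy)
...   | no ¬x-very-heavy with pigeonhole-except f x (s≤s⁻¹ (≰⇒> ¬x-very-heavy)) big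
...     | y , y≢x , y-heavy = inj₂ (x , y , y≢x , x-heavy , y-heavy)

∑-truncate : ∀ {n} (f : Fin n → ℕ) {j} → j ≤ ∑ f →
             ∃[ g ] (∀ x → g x ≤ f x) × ∑ g ≡ j
∑-truncate {zero}  f j≤0 = (λ ()) , (λ ()) , sym (n≤0⇒n≡0 j≤0)
∑-truncate {suc n} f j≤∑f with +-split (f zero) (∑ (f ∘ suc)) j≤∑f
... | j₁ , j₂ , j₁≤ , j₂≤ , refl with ∑-truncate (f ∘ suc) j₂≤
...   | g , g≤f , refl = g′ , g′≤f , refl
  where
  g′ : Fin (suc n) → ℕ
  g′ zero    = j₁
  g′ (suc x) = g x
  g′≤f : ∀ x → g′ x ≤ f x
  g′≤f zero    = j₁≤
  g′≤f (suc x) = g≤f x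

spike : ∀ {n} → Fin n → ℕ → Fin n → ℕ
spike z c h with h ≟ᶠ z
... | yes _ = c
... | no _  = 1

spike-at : ∀ {n} (z : Fin n) c → spike z c z ≡ c
spike-at z c with z ≟ᶠ z
... | yes _   = refl
... | no z≢z = contradiction refl z≢z

spike-off : ∀ {n} {z h : Fin n} c → h ≢ z → spike z c h ≡ 1
spike-off {z = z} {h} c h≢z with h ≟ᶠ z
... | yes h≡z = contradiction h≡z h≢z
... | no _    = refl

∑-spike : ∀ {n} (z : Fin n) c → ∑ (spike z c) + 1 ≡ n + c
∑-spike {suc n} z c = begin
  ∑ (spike z c) + 1
    ≡⟨ cong (_+ 1) (sum-remove (spike z c)) ⟩
  spike z c z + ∑ (removeAt (spike z c) z) + 1
    ≡⟨ cong₂ (λ a b → a + b + 1) (spike-at z c) ∑-rest ⟩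
  c + n * 1 + 1
    ≡⟨ solve (c ∷ n ∷ []) ⟩
  suc n + c ∎
  where
  open ≡-Reasoning
  ∑-rest : ∑ (removeAt (spike z c) z) ≡ n * 1
  ∑-rest = trans (sum-cong-≗ (λ y → spike-off c (punchInᵢ≢i z y))) (∑-const n 1)

spike-≤ : ∀ {n} (z : Fin n) {c d} h → c ≤ d → 1 ≤ d → spike z c h ≤ d
spike-≤ z h c≤d 1≤d with h ≟ᶠ z
... | yes _ = c≤d
... | no _  = 1≤d

length≡sum-ones : ∀ {A : Set} (xs : List A) → length xs ≡ sum (map (λ _ → 1) xs)
length≡sum-ones []       = refl
length≡sum-ones (_ ∷ xs) = cong suc (length≡sum-ones xs)

sum-map-allFin : ∀ {n} (f : Fin n → ℕ) → sum (map f (allFin n)) ≡ ∑ f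
sum-map-allFin f = trans (cong sum (map-tabulate id f)) (sum-tabulate f)
  where
  sum-tabulate : ∀ {n} (f : Fin n → ℕ) → sum (tabulate f) ≡ ∑ f
  sum-tabulate {zero}  f = refl
  sum-tabulate {suc n} f = cong (f zero +_) (sum-tabulate (f ∘ suc))

sum-map-concatMap : ∀ {A B : Set} (f : B → ℕ) (F : A → List B) xs →
                    sum (map f (concatMap F xs)) ≡ sum (map (λ x → sum (map f (F x))) xs)
sum-map-concatMap f F []       = refl
sum-map-concatMap f F (x ∷ xs) = begin
  sum (map f (F x ++ concatMap F xs))                ≡⟨ cong sum (map-++ f (F x) _) ⟩
  sum (map f (F x) ++ map f (concatMap F xs))        ≡⟨ sum-++ (map f (F x)) _ ⟩
  sum (map f (F x)) + sum (map f (concatMap F xs))   ≡⟨ cong (_ +_) (sum-map-concatMap f F xs) ⟩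
  sum (map f (F x)) + sum (map (λ x → sum (map f (F x))) xs) ∎
  where open ≡-Reasoning

-- Pebbles on a clique

-- Surplus f t: the clique carrying f can push at most t more pebbles out of itself.
data Surplus {n} (f : Fin n → ℕ) : ℕ → Set where
  none : (∀ h → f h ≤ 1) → Surplus f 0
  one  : ∀ x → f x ≤ 3 → (∀ h → h ≢ x → f h ≤ 1) → Surplus f 1

module _ {n} {f g : Fin n → ℕ} where

  surplus-mono : ∀ {t} → (∀ h → g h ≤ f h) → Surplus f t → Surplus g t
  surplus-mono g≤f (none light)      = none (λ h → ≤-trans (g≤f h) (light h))
  surplus-mono g≤f (one x x≤3 light) =
    one x (≤-trans (g≤f x) x≤3) (λ h h≢x → ≤-trans (g≤f h) (light h h≢x))

  surplus-send : ∀ {t x} → Surplus f t → g x + 2 ≡ f x → (∀ h → h ≢ x → g h ≤ f h) →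
                 t ≡ 1 × Surplus g 0
  surplus-send {x = x} (none light) sent _ =
    contradiction (light x) (sending⇒≰1 sent)
  surplus-send {x = x} (one y y≤3 light) sent rest with x ≟ᶠ y
  ... | no x≢y  = contradiction (light x x≢y) (sending⇒≰1 sent)
  ... | yes refl = refl , none light′
    where
    light′ : ∀ h → g h ≤ 1
    light′ h with h ≟ᶠ x
    ... | yes refl = ≤1-after-sending sent y≤3
    ... | no h≢x   = ≤-trans (rest h h≢x) (light h h≢x)

  surplus-shift : ∀ {t x y} → Surplus f t → g x + 2 ≡ f x → g y ≡ f y + 1 → y ≢ x →
                  (∀ h → h ≢ y → g h ≤ f h) → Surplus g t
  surplus-shift {x = x} (none light) sent _ _ _ =
    contradiction (light x) (sending⇒≰1 sent)
  surplus-shift {x = x} {y} (one z z≤3 light) sent received y≢x rest with x ≟ᶠ z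
  ... | no x≢z  = contradiction (light x x≢z) (sending⇒≰1 sent)
  ... | yes refl = one y y≤3 light′
    where
    y≤3 : g y ≤ 3
    y≤3 = ≤-trans (≤-reflexive received) (+-monoˡ-≤ 1 (≤-trans (light y y≢x) (n≤1+n 1)))
    light′ : ∀ h → h ≢ y → g h ≤ 1
    light′ h h≢y with h ≟ᶠ x
    ... | yes refl = ≤1-after-sending sent z≤3
    ... | no h≢x   = ≤-trans (rest h h≢y) (light h h≢x)

  surplus-receive : ∀ {y} → Surplus f 0 → g y ≡ f y + 1 → (∀ h → h ≢ y → g h ≤ f h) →
                    Surplus g 1
  surplus-receive {y} (none light) received rest =
    one y (≤-trans (≤-reflexive received) (+-monoˡ-≤ 1 (≤-trans (light y) (n≤1+n 1))))
          (λ h h≢y → ≤-trans (rest h h≢y) (light h))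

surplus-under-spike : ∀ {n} {g : Fin n → ℕ} z {c} → (∀ h → g h ≤ spike z c h) → c ≤ 3 →
                      Surplus g 1
surplus-under-spike z {c} g≤ c≤3 =
  one z (≤-trans (≤-trans (g≤ z) (≤-reflexive (spike-at z c))) c≤3)
        (λ h h≢z → ≤-trans (g≤ h) (≤-reflexive (spike-off c h≢z)))

light-of-surplus : ∀ {n} {f : Fin n → ℕ} → Surplus f 0 → ∀ h → f h ≤ 1
light-of-surplus (none light) = light

record Sparse {n} (z : Fin n) (f : Fin n → ℕ) : Set where
  field
    empty-at  : f z ≤ 0
    light-off : ∀ h → h ≢ z → f h ≤ 1

sparse-mono : ∀ {n} {z : Fin n} {f g} → (∀ h → g h ≤ f h) → Sparse z f → Sparse z g
sparse-mono g≤f record { empty-at = empty ; light-off = light } = record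
  { empty-at  = ≤-trans (g≤f _) empty
  ; light-off = λ h h≢z → ≤-trans (g≤f h) (light h h≢z) }

sparse-light : ∀ {n} {z : Fin n} {f} → Sparse z f → ∀ h → f h ≤ 1
sparse-light {z = z} sparse h with h ≟ᶠ z
... | yes refl = ≤-trans (Sparse.empty-at sparse) z≤n
... | no h≢z   = Sparse.light-off sparse h h≢z

-- Capped a t b s bounds what could ever gather on a hub u j next to the root's copy H i:
-- a pebbles on u j, the surplus t of the copy H k adjacent to u j, b pebbles on u i and the
-- surplus s of H j; the last two reach u j only through another hub and so count half.
record Capped (a t b s : ℕ) : Set where
  constructor capped
  field bound : 2 * (a + t) + (b + s) ≤ 3

module _ {a a′ t t′ b b′ s s′ : ℕ} where

  capped-≤ : 2 * (a′ + t′) + (b′ + s′) ≤ 2 * (a + t) + (b + s) →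
             Capped a t b s → Capped a′ t′ b′ s′
  capped-≤ le (capped bound) = capped (≤-trans le bound)

  capped-mono : a′ ≤ a → t′ ≤ t → b′ ≤ b → s′ ≤ s →
                Capped a t b s → Capped a′ t′ b′ s′
  capped-mono a′≤a t′≤t b′≤b s′≤s =
    capped-≤ (+-mono-≤ (*-monoʳ-≤ 2 (+-mono-≤ a′≤a t′≤t)) (+-mono-≤ b′≤b s′≤s))

capped-hub-mono : ∀ {a a′ t b s} → a′ ≤ a → Capped a t b s → Capped a′ t b s
capped-hub-mono a′≤a = capped-mono a′≤a ≤-refl ≤-refl ≤-refl

capped-relay-mono : ∀ {a t b b′ s} → b′ ≤ b → Capped a t b s → Capped a t b′ s
capped-relay-mono b′≤b = capped-mono ≤-refl ≤-refl b′≤b ≤-refl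

capped⇒≤1 : ∀ {a t b s} → Capped a t b s → a ≤ 1
capped⇒≤1 {a} a-capped with ≤-<-connex a 1
... | inj₁ a≤1 = a≤1
... | inj₂ 1<a = contradiction (capped-mono 1<a z≤n z≤n z≤n a-capped) ¬capped
  where
  ¬capped : ¬ Capped 2 0 0 0
  ¬capped (capped 4≤3) = 1+n≰n 4≤3

capped-heavy⇒t≡0 : ∀ {a t b s} → 2 ≤ b → Capped a t b s → t ≡ 0
capped-heavy⇒t≡0 {t = zero}  _   _      = refl
capped-heavy⇒t≡0 {t = suc _} 2≤b t-capped =
  contradiction (capped-mono z≤n (s≤s z≤n) 2≤b z≤n t-capped) ¬capped
  where
  ¬capped : ¬ Capped 0 1 2 0
  ¬capped (capped 4≤3) = 1+n≰n 4≤3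

capped-relay→hub : ∀ {a a′ t b b′ s} → a′ ≡ a + 1 → b′ + 2 ≡ b →
                   Capped a t b s → Capped a′ t b′ s
capped-relay→hub {a} {t = t} {b′ = b′} {s} refl refl =
  capped-≤ (≤-reflexive (solve (a ∷ t ∷ b′ ∷ s ∷ [])))

capped-relay→relay-copy : ∀ {a b b′} → b′ + 2 ≡ b → Capped a 0 b 0 → Capped a 0 b′ 1
capped-relay→relay-copy {a} {b′ = b′} refl = capped-≤ (begin
  2 * (a + 0) + (b′ + 1)      ≡⟨ solve (a ∷ b′ ∷ []) ⟩
  1 + (2 * a + b′)            ≤⟨ n≤1+n _ ⟩
  2 + (2 * a + b′)            ≡⟨ solve (a ∷ b′ ∷ []) ⟩
  2 * (a + 0) + (b′ + 2 + 0)  ∎)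
  where open ≤-Reasoning

capped-relay→hub-copy : ∀ {a b b′} → b′ + 2 ≡ b → Capped a 0 b 0 → Capped a 1 b′ 0
capped-relay→hub-copy {a} {b′ = b′} refl = capped-≤ (≤-reflexive (solve (a ∷ b′ ∷ [])))

capped-relay-copy→relay : ∀ {a t b b′} → b′ ≡ b + 1 → Capped a t b 1 → Capped a t b′ 0
capped-relay-copy→relay {a} {t} {b} refl = capped-≤ (≤-reflexive (solve (a ∷ t ∷ b ∷ [])))

capped-hub-copy→relay : ∀ {a b b′ s} → b′ ≡ b + 1 → Capped a 1 b s → Capped a 0 b′ s
capped-hub-copy→relay {a} {b} {s = s} refl = capped-≤ (begin
  2 * (a + 0) + (b + 1 + s)   ≡⟨ solve (a ∷ b ∷ s ∷ []) ⟩
  1 + (2 * a + (b + s))       ≤⟨ n≤1+n _ ⟩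
  2 + (2 * a + (b + s))       ≡⟨ solve (a ∷ b ∷ s ∷ []) ⟩
  2 * (a + 1) + (b + s)       ∎)
  where open ≤-Reasoning

capped-hub-copy→hub : ∀ {a a′ b s} → a′ ≡ a + 1 → Capped a 1 b s → Capped a′ 0 b s
capped-hub-copy→hub {a} {b = b} {s} refl = capped-≤ (≤-reflexive (solve (a ∷ b ∷ s ∷ [])))

-- Pebbling on an arbitrary graph

module Pebbling (G : Graph) (_≟_ : DecidableEquality (V G))
                (adj⇒≢ : ∀ {u v} → Adj G u v → u ≢ v) where

  _≤ᶜ_ : Config G → Config G → Set
  φ ≤ᶜ ψ = ∀ w → φ w ≤ ψ w

  -- Opaque, so that goals about `move φ u v w` are not unfolded into its with-abstraction,
  -- which would block unification with the lemmas below.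
  opaque
    move : Config G → V G → V G → Config G
    move φ u v w with w ≟ u | w ≟ v
    ... | yes _ | _     = φ w ∸ 2
    ... | no _  | yes _ = φ w + 1
    ... | no _  | no _  = φ w

    move-source : ∀ φ u v → move φ u v u ≡ φ u ∸ 2
    move-source φ u v with u ≟ u
    ... | yes _   = refl
    ... | no u≢u = contradiction refl u≢u

    move-target : ∀ φ {u v} → u ≢ v → move φ u v v ≡ φ v + 1
    move-target φ {u} {v} u≢v with v ≟ u | v ≟ v
    ... | yes v≡u | _       = contradiction (sym v≡u) u≢v
    ... | no _    | yes _   = refl
    ... | no _    | no v≢v = contradiction refl v≢v

    move-other : ∀ φ {u v w} → w ≢ u → w ≢ v → move φ u v w ≡ φ w
    move-other φ {u} {v} {w} w≢u w≢v with w ≟ u | w ≟ v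
    ... | yes w≡u | _       = contradiction w≡u w≢u
    ... | no _    | yes w≡v = contradiction w≡v w≢v
    ... | no _    | no _    = refl

  move-step : ∀ {φ u v} → Adj G u v → 2 ≤ φ u → Step G φ (move φ u v)
  move-step {φ} {u} {v} uv 2≤φu =
    u , v , uv , trans (cong (_+ 2) (move-source φ u v)) (m∸n+n≡m 2≤φu) ,
    move-target φ (adj⇒≢ uv) , λ w → move-other φ

  ≤-move-source : ∀ {φ u v c} → c + 2 ≤ φ u → c ≤ move φ u v u
  ≤-move-source {φ} {u} {v} {c} c+2≤ =
    subst (c ≤_) (sym (move-source φ u v)) (m+n≤o⇒m≤o∸n c c+2≤)

  ≤-move-target : ∀ {φ u v c} → Adj G u v → c ≤ φ v → c + 1 ≤ move φ u v v
  ≤-move-target {φ} uv c≤ =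
    subst (_ ≤_) (sym (move-target φ (adj⇒≢ uv))) (+-monoˡ-≤ 1 c≤)

  ≤-move-other : ∀ {φ u v w c} → w ≢ u → w ≢ v → c ≤ φ w → c ≤ move φ u v w
  ≤-move-other {φ} w≢u w≢v c≤ = subst (_ ≤_) (sym (move-other φ w≢u w≢v)) c≤

  solvable-occupied : ∀ {φ r} → 1 ≤ φ r → Solvable G φ r
  solvable-occupied {φ} occupied = φ , ε , occupied

  solvable-by-move : ∀ {φ r} x y → Adj G x y → 2 ≤ φ x →
                     Solvable G (move φ x y) r → Solvable G φ r
  solvable-by-move x y xy 2≤x (ψ , moves , occupied) = ψ , move-step xy 2≤x ◅ moves , occupied

  solvable-from-neighbour : ∀ {φ r} x → Adj G x r → 2 ≤ φ x → Solvable G φ r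
  solvable-from-neighbour {r = r} x xr 2≤x =
    solvable-by-move x r xr 2≤x (solvable-occupied (≤-move-target xr z≤n))

  solvable-along-path : ∀ {φ r} x y → Adj G x y → Adj G y r → 2 ≤ φ x → 1 ≤ φ y →
                        Solvable G φ r
  solvable-along-path x y xy yr 2≤x 1≤y =
    solvable-by-move x y xy 2≤x (solvable-from-neighbour y yr (≤-move-target xy 1≤y))

  solvable-from-distance-two : ∀ {φ r} x y → Adj G x y → Adj G y r → 4 ≤ φ x →
                               Solvable G φ r
  solvable-from-distance-two x y xy yr 4≤x =
    solvable-by-move x y xy (≤-trans (m≤n+m 2 2) 4≤x)
      (solvable-along-path x y xy yr (≤-move-source 4≤x) (≤-move-target xy z≤n))

  solvable-via-common-neighbour : ∀ {φ r} x y w → y ≢ x →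
                                  Adj G x w → Adj G y w → Adj G w r →
                                  2 ≤ φ x → 2 ≤ φ y → Solvable G φ r
  solvable-via-common-neighbour x y w y≢x xw yw wr 2≤x 2≤y =
    solvable-by-move x w xw 2≤x
      (solvable-along-path y w yw wr (≤-move-other y≢x (adj⇒≢ yw) 2≤y)
                                     (≤-move-target xw z≤n))

  solvable-from-neighbours : ∀ {n φ r} (vs : Fin n → V G) → (∀ h → Adj G (vs h) r) →
                             suc n ≤ ∑ (φ ∘ vs) → Solvable G φ r
  solvable-from-neighbours vs adj big with pigeonhole _ big
  ... | x , x-heavy = solvable-from-neighbour (vs x) (adj x) x-heavy

  solvable-from-neighbours-except : ∀ {n φ r} (vs : Fin n → V G) z → φ (vs z) ≤ 0 →
                                    (∀ h → h ≢ z → Adj G (vs h) r) → n ≤ ∑ (φ ∘ vs) →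
                                    Solvable G φ r
  solvable-from-neighbours-except vs z empty adj big with pigeonhole-except _ z empty big
  ... | x , x≢z , x-heavy = solvable-from-neighbour (vs x) (adj x x≢z) x-heavy

  solvable-through : ∀ {n φ r} (vs : Fin n → V G) w → Injective _≡_ _≡_ vs →
                     (∀ h → Adj G (vs h) w) → Adj G w r → 3 + n ≤ ∑ (φ ∘ vs) →
                     Solvable G φ r
  solvable-through vs w vs-injective adj wr big with pigeonhole₂ _ big
  ... | inj₁ (x , 4≤x) = solvable-from-distance-two (vs x) w (adj x) wr 4≤x
  ... | inj₂ (x , y , y≢x , 2≤x , 2≤y) =
    solvable-via-common-neighbour (vs x) (vs y) w (y≢x ∘ vs-injective)
                                  (adj x) (adj y) wr 2≤x 2≤y

  StepAt : Config G → Config G → V G → V G → Set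
  StepAt φ ψ u v =
    (ψ u + 2 ≡ φ u) × (ψ v ≡ φ v + 1) × (∀ w → w ≢ u → w ≢ v → ψ w ≡ φ w)

  source-≥2 : ∀ {φ ψ u v} → StepAt φ ψ u v → 2 ≤ φ u
  source-≥2 {ψ = ψ} {u} (sent , _) = ≤-trans (m≤n+m 2 (ψ u)) (≤-reflexive sent)

  source-≰1 : ∀ {φ ψ u v} → StepAt φ ψ u v → ¬ φ u ≤ 1
  source-≰1 (sent , _) = sending⇒≰1 sent

  ≤-off-target : ∀ {φ ψ u v} → StepAt φ ψ u v → ∀ w → w ≢ v → ψ w ≤ φ w
  ≤-off-target {ψ = ψ} {u} (sent , _ , rest) w w≢v with w ≟ u
  ... | yes refl = ≤-trans (m≤m+n (ψ u) 2) (≤-reflexive sent)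
  ... | no w≢u   = ≤-reflexive (rest w w≢u w≢v)

  ≤-after-step : ∀ {φ ψ u v} → StepAt φ ψ u v → ∀ w → ψ w ≤ φ w + 1
  ≤-after-step {φ} {v = v} st@(_ , received , _) w with w ≟ v
  ... | yes refl = ≤-reflexive received
  ... | no w≢v   = ≤-trans (≤-off-target st w w≢v) (m≤m+n (φ w) 1)

  StepClosed : (Config G → Set) → Set
  StepClosed I = ∀ {φ ψ} → Step G φ ψ → I φ → I ψ

  unsolvable-by-invariant : ∀ {I : Config G → Set} {r} → StepClosed I →
                            (∀ {φ} → I φ → φ r ≤ 0) → ∀ {φ} → I φ → ¬ Solvable G φ r
  unsolvable-by-invariant {I} closed empty Iφ (ψ , moves , occupied) =
    <⇒≱ occupied (empty (reachable moves Iφ))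
    where
    reachable : ∀ {φ ψ} → Star (Step G) φ ψ → I φ → I ψ
    reachable = fold (λ φ ψ → I φ → I ψ) (λ step k → k ∘ closed step) id

  Truncatable : Set
  Truncatable = ∀ φ {j} → j ≤ size G φ → ∃[ ψ ] ψ ≤ᶜ φ × size G ψ ≡ j

  rooted-pebbling-number : Truncatable → ∀ {r} φ₀ →
                           (∀ ψ → ψ ≤ᶜ φ₀ → ¬ Solvable G ψ r) →
                           AllSolvable G r (suc (size G φ₀)) →
                           IsRootedPebblingNumber G r (suc (size G φ₀))
  rooted-pebbling-number truncate φ₀ unsolvable solvable = s≤s z≤n , solvable , smaller-fail
    where
    smaller-fail : ∀ j → 0 < j → j < suc (size G φ₀) → ¬ AllSolvable G _ j
    smaller-fail j _ j≤size all-solvable with truncate φ₀ (s≤s⁻¹ j≤size)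
    ... | ψ , ψ≤φ₀ , size≡j = unsolvable ψ ψ≤φ₀ (all-solvable ψ size≡j)

-- The neighbourhood corona K n ⋆ K m

module Corona (n m : ℕ) where

  G : Graph
  G = K n ⋆ K m

  _≟ᵥ_ : DecidableEquality (V G)
  _≟ᵥ_ = ≡-dec _≟ᶠ_ (Product.≡-dec _≟ᶠ_ _≟ᶠ_)

  adj⇒≢ : ∀ {u v} → Adj G u v → u ≢ v
  adj⇒≢ {inj₁ _} {inj₁ _} a≢a       refl = a≢a refl
  adj⇒≢ {inj₂ _} {inj₂ _} (_ , h≢h) refl = h≢h refl

  open Pebbling G _≟ᵥ_ adj⇒≢ public

  u : Fin n → V G
  u = inj₁

  H : Fin n → Fin m → V G
  H b h = inj₂ (b , h)

  H-injective : ∀ {b} → Injective _≡_ _≡_ (H b)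
  H-injective refl = refl

  copies-disjoint : ∀ {a b x y} → a ≢ b → H a x ≢ H b y
  copies-disjoint a≢b refl = a≢b refl

  hub-misses-own-copy : ∀ {a v} → Adj G (u a) v → ∀ h → H a h ≢ v
  hub-misses-own-copy a≢a h refl = a≢a refl

  copy-misses-other-copies : ∀ {a b x v} → b ≢ a → Adj G (H b x) v → ∀ h → H a h ≢ v
  copy-misses-other-copies b≢a (b≡a , _) h refl = b≢a b≡a

  copy : Config G → Fin n → Fin m → ℕ
  copy φ b h = φ (H b h)

  load : Config G → Fin n → ℕ
  load φ b = ∑ (copy φ b)

  size-⋆ : ∀ φ → size G φ ≡ ∑ (φ ∘ u) + ∑ (load φ)
  size-⋆ φ = begin
    sum (map φ (map u (allFin n) ++ concatMap copyᵛ (allFin n)))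
      ≡⟨ cong sum (map-++ φ (map u (allFin n)) _) ⟩
    sum (map φ (map u (allFin n)) ++ map φ (concatMap copyᵛ (allFin n)))
      ≡⟨ sum-++ (map φ (map u (allFin n))) _ ⟩
    sum (map φ (map u (allFin n))) + sum (map φ (concatMap copyᵛ (allFin n)))
      ≡⟨ cong₂ _+_ on-hubs on-copies ⟩
    ∑ (φ ∘ u) + ∑ (load φ) ∎
    where
    open ≡-Reasoning
    copyᵛ : Fin n → List (V G)
    copyᵛ b = map (H b) (allFin m)
    on-hubs : sum (map φ (map u (allFin n))) ≡ ∑ (φ ∘ u)
    on-hubs = trans (cong sum (sym (map-∘ (allFin n)))) (sum-map-allFin (φ ∘ u))
    on-copy : ∀ b → sum (map φ (copyᵛ b)) ≡ load φ b
    on-copy b = trans (cong sum (sym (map-∘ (allFin m)))) (sum-map-allFin (copy φ b))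
    on-copies : sum (map φ (concatMap copyᵛ (allFin n))) ≡ ∑ (load φ)
    on-copies = trans (sum-map-concatMap φ copyᵛ (allFin n))
                      (trans (sum-map-allFin (sum ∘ map φ ∘ copyᵛ)) (sum-cong-≗ on-copy))

  truncatable : Truncatable
  truncatable φ j≤size
    with +-split (∑ (φ ∘ u)) (∑ (load φ)) (≤-trans j≤size (≤-reflexive (size-⋆ φ)))
  ... | j₁ , j₂ , j₁≤ , j₂≤ , refl
    with ∑-truncate (φ ∘ u) j₁≤ | ∑-truncate (load φ) j₂≤
  ... | g , g≤ , refl | l , l≤ , refl =
    ψ , ψ≤φ , trans (size-⋆ ψ) (cong (∑ g +_) (sum-cong-≗ load-ψ))
    where
    copy-truncate : ∀ b → ∃[ c ] (∀ h → c h ≤ copy φ b h) × ∑ c ≡ l b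
    copy-truncate b = ∑-truncate (copy φ b) (l≤ b)
    ψ : Config G
    ψ (inj₁ a)       = g a
    ψ (inj₂ (b , h)) = proj₁ (copy-truncate b) h
    ψ≤φ : ψ ≤ᶜ φ
    ψ≤φ (inj₁ a)       = g≤ a
    ψ≤φ (inj₂ (b , h)) = proj₁ (proj₂ (copy-truncate b)) h
    load-ψ : ∀ b → load ψ b ≡ l b
    load-ψ b = proj₂ (proj₂ (copy-truncate b))

  order-⋆ : order G ≡ n * 1 + n * (m * 1)
  order-⋆ = begin
    order G                                  ≡⟨ length≡sum-ones (vertices G) ⟩
    size G (λ _ → 1)                         ≡⟨ size-⋆ (λ _ → 1) ⟩
    ∑ {n} (λ _ → 1) + ∑ {n} (λ _ → ∑ {m} (λ _ → 1))
      ≡⟨ cong₂ _+_ (∑-const n 1)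
                   (trans (sum-cong-≗ {n} (λ _ → ∑-const m 1)) (∑-const n (m * 1))) ⟩
    n * 1 + n * (m * 1)                      ∎
    where open ≡-Reasoning

-- The corona K 3 ⋆ K m

record Others (i : Fin 3) : Set where
  field
    j k         : Fin 3
    i≢j         : i ≢ j
    j≢k         : j ≢ k
    i≢k         : i ≢ k
    cover       : ∀ a → a ≡ i ⊎ a ≡ j ⊎ a ≡ k
    ∑-by-others : ∀ f → ∑ f ≡ f i + f j + f k

  j≢i : j ≢ i
  j≢i = i≢j ∘ sym

  k≢j : k ≢ j
  k≢j = j≢k ∘ sym

  k≢i : k ≢ i
  k≢i = i≢k ∘ sym

others : ∀ i → Others i
others 0F = record
  { j = 1F ; k = 2F ; i≢j = λ () ; j≢k = λ () ; i≢k = λ ()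
  ; cover = λ { 0F → inj₁ refl ; 1F → inj₂ (inj₁ refl) ; 2F → inj₂ (inj₂ refl) }
  ; ∑-by-others = λ f → regroup (f 0F) (f 1F) (f 2F) }
  where
  regroup : ∀ a b c → a + (b + (c + 0)) ≡ a + b + c
  regroup = solve-∀
others 1F = record
  { j = 2F ; k = 0F ; i≢j = λ () ; j≢k = λ () ; i≢k = λ ()
  ; cover = λ { 0F → inj₂ (inj₂ refl) ; 1F → inj₁ refl ; 2F → inj₂ (inj₁ refl) }
  ; ∑-by-others = λ f → regroup (f 0F) (f 1F) (f 2F) }
  where
  regroup : ∀ a b c → a + (b + (c + 0)) ≡ b + c + a
  regroup = solve-∀
others 2F = record
  { j = 0F ; k = 1F ; i≢j = λ () ; j≢k = λ () ; i≢k = λ ()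
  ; cover = λ { 0F → inj₂ (inj₁ refl) ; 1F → inj₂ (inj₂ refl) ; 2F → inj₁ refl }
  ; ∑-by-others = λ f → regroup (f 0F) (f 1F) (f 2F) }
  where
  regroup : ∀ a b c → a + (b + (c + 0)) ≡ c + a + b
  regroup = solve-∀

swap : ∀ {i} → Others i → Others i
swap {i} o = record
  { j = k ; k = j ; i≢j = i≢k ; j≢k = k≢j ; i≢k = i≢j
  ; cover = Sum.map₂ Sum.swap ∘ cover
  ; ∑-by-others = λ f → trans (∑-by-others f) (xy∙z≈xz∙y (f i) (f j) (f k)) }
  where open Others o

module TriangleCorona (m : ℕ) where

  open Corona 3 m public

  record Potential (i j k : Fin 3) (ψ : Config G) : Set where
    field
      tj tk     : ℕ
      surplus-j : Surplus (copy ψ j) tj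
      surplus-k : Surplus (copy ψ k) tk
      capped-j  : Capped (ψ (u j)) tk (ψ (u i)) tj
      capped-k  : Capped (ψ (u k)) tj (ψ (u i)) tk

  swap-potential : ∀ {i j k ψ} → Potential i j k ψ → Potential i k j ψ
  swap-potential p = record
    { tj = tk ; tk = tj ; surplus-j = surplus-k ; surplus-k = surplus-j
    ; capped-j = capped-k ; capped-k = capped-j }
    where open Potential p

  module PotentialSteps {i} (o : Others i) where
    open Others o

    potential-ui→uj : ∀ {φ ψ} → StepAt φ ψ (u i) (u j) →
                      Potential i j k φ → Potential i j k ψ
    potential-ui→uj st@(sent , received , _) p = record
      { tj = tj ; tk = tk
      ; surplus-j = surplus-mono (λ h → ≤-off-target st (H j h) λ ()) surplus-j
      ; surplus-k = surplus-mono (λ h → ≤-off-target st (H k h) λ ()) surplus-k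
      ; capped-j  = capped-relay→hub received sent capped-j
      ; capped-k  = capped-mono (≤-off-target st (u k) (adj⇒≢ k≢j)) ≤-refl
                                (≤-off-target st (u i) (adj⇒≢ i≢j)) ≤-refl capped-k
      }
      where open Potential p

    potential-ui→Hj : ∀ {φ ψ y} → StepAt φ ψ (u i) (H j y) →
                      Potential i j k φ → Potential i j k ψ
    potential-ui→Hj st@(sent , received , _)
                    record { tj = tj ; tk = tk ; surplus-j = sj ; surplus-k = sk
                           ; capped-j = cj ; capped-k = ck }
      with capped-heavy⇒t≡0 (source-≥2 st) cj | capped-heavy⇒t≡0 (source-≥2 st) ck
    ... | refl | refl = record
      { tj = 1 ; tk = 0
      ; surplus-j = surplus-receive sj received
                      (λ h h≢y → ≤-off-target st (H j h) (h≢y ∘ H-injective))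
      ; surplus-k = surplus-mono (λ h → ≤-off-target st (H k h) (copies-disjoint k≢j)) sk
      ; capped-j  = capped-relay→relay-copy sent (capped-hub-mono (≤-off-target st (u j) λ ()) cj)
      ; capped-k  = capped-relay→hub-copy sent (capped-hub-mono (≤-off-target st (u k) λ ()) ck)
      }

    potential-Hj→ui : ∀ {φ ψ x} → StepAt φ ψ (H j x) (u i) →
                      Potential i j k φ → Potential i j k ψ
    potential-Hj→ui st@(sent , received , _)
                    record { tj = tj ; tk = tk ; surplus-j = sj ; surplus-k = sk
                           ; capped-j = cj ; capped-k = ck }
      with surplus-send sj sent (λ h _ → ≤-off-target st (H j h) λ ())
    ... | refl , sj′ = record
      { tj = 0 ; tk = tk
      ; surplus-j = sj′
      ; surplus-k = surplus-mono (λ h → ≤-off-target st (H k h) λ ()) sk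
      ; capped-j  = capped-relay-copy→relay received
                      (capped-hub-mono (≤-off-target st (u j) (adj⇒≢ j≢i)) cj)
      ; capped-k  = capped-hub-copy→relay received
                      (capped-hub-mono (≤-off-target st (u k) (adj⇒≢ k≢i)) ck)
      }

    potential-Hj→uk : ∀ {φ ψ x} → StepAt φ ψ (H j x) (u k) →
                      Potential i j k φ → Potential i j k ψ
    potential-Hj→uk st@(sent , received , _)
                    record { tj = tj ; tk = tk ; surplus-j = sj ; surplus-k = sk
                           ; capped-j = cj ; capped-k = ck }
      with surplus-send sj sent (λ h _ → ≤-off-target st (H j h) λ ())
    ... | refl , sj′ = record
      { tj = 0 ; tk = tk
      ; surplus-j = sj′
      ; surplus-k = surplus-mono (λ h → ≤-off-target st (H k h) λ ()) sk
      ; capped-j  = capped-mono (≤-off-target st (u j) (adj⇒≢ j≢k)) ≤-refl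
                                (≤-off-target st (u i) (adj⇒≢ i≢k)) z≤n cj
      ; capped-k  = capped-hub-copy→hub received
                      (capped-relay-mono (≤-off-target st (u i) (adj⇒≢ i≢k)) ck)
      }

    potential-Hj→Hj : ∀ {φ ψ x y} → y ≢ x → StepAt φ ψ (H j x) (H j y) →
                      Potential i j k φ → Potential i j k ψ
    potential-Hj→Hj y≢x st@(sent , received , _) p = record
      { tj = tj ; tk = tk
      ; surplus-j = surplus-shift surplus-j sent received y≢x
                      (λ h h≢y → ≤-off-target st (H j h) (h≢y ∘ H-injective))
      ; surplus-k = surplus-mono (λ h → ≤-off-target st (H k h) (copies-disjoint k≢j)) surplus-k
      ; capped-j  = capped-mono (≤-off-target st (u j) λ ()) ≤-refl
                                (≤-off-target st (u i) λ ()) ≤-refl capped-j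
      ; capped-k  = capped-mono (≤-off-target st (u k) λ ()) ≤-refl
                                (≤-off-target st (u i) λ ()) ≤-refl capped-k
      }
      where open Potential p

    potential-from-Hj : ∀ {φ ψ x v} → Adj G (H j x) v → StepAt φ ψ (H j x) v →
                        Potential i j k φ → Potential i j k ψ
    potential-from-Hj {v = inj₁ a} j≢a st with cover a
    ... | inj₁ refl        = potential-Hj→ui st
    ... | inj₂ (inj₁ refl) = contradiction refl j≢a
    ... | inj₂ (inj₂ refl) = potential-Hj→uk st
    potential-from-Hj {v = inj₂ _} (refl , x≢y) st = potential-Hj→Hj (x≢y ∘ sym) st

  module CliqueSolvability {i} (o : Others i) where
    open Others o
    open ≤-Reasoning

    clique-solvable-via-uj : ∀ ρ φ → 1 ≤ φ (u j) → load φ j ≤ 2 + m →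
                             3 + (m + m) ≤ φ (u i) + (load φ j + load φ k) →
                             Solvable G φ (H i ρ)
    clique-solvable-via-uj ρ φ 1≤uj Hj≤2+m budget
      with ≤-<-connex (φ (u i)) 1 | ≤-<-connex (load φ k) m
    ... | inj₂ 1<ui | _ = solvable-along-path (u i) (u j) i≢j j≢i 1<ui 1≤uj
    ... | inj₁ _ | inj₂ m<Hk =
      let (y , y-heavy) = pigeonhole (copy φ k) m<Hk
      in solvable-along-path (H k y) (u j) k≢j j≢i y-heavy 1≤uj
    ... | inj₁ ui≤1 | inj₁ Hk≤m =
      let (x , x-heavy) = pigeonhole (copy φ j) m<Hj
      in solvable-by-move (H j x) (u i) j≢i x-heavy
           (solvable-along-path (u i) (u j) i≢j j≢i (≤-move-target j≢i 1≤ui)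
                                        (≤-move-other (λ ()) (adj⇒≢ j≢i) 1≤uj))
      where
      1≤ui : 1 ≤ φ (u i)
      1≤ui = +-cancel-bounded (+-mono-≤ Hj≤2+m Hk≤m) (begin
        2 + m + m + 1                     ≡⟨ solve (m ∷ []) ⟩
        3 + (m + m)                       ≤⟨ budget ⟩
        φ (u i) + (load φ j + load φ k)   ≡⟨ +-comm (φ (u i)) _ ⟩
        load φ j + load φ k + φ (u i)     ∎)
      m<Hj : suc m ≤ load φ j
      m<Hj = ≤-trans (n≤1+n (suc m)) (+-cancel-bounded (+-mono-≤ ui≤1 Hk≤m) (begin
        1 + m + (2 + m)                   ≡⟨ solve (m ∷ []) ⟩
        3 + (m + m)                       ≤⟨ budget ⟩
        φ (u i) + (load φ j + load φ k)   ≡⟨ x∙yz≈xz∙y (φ (u i)) _ _ ⟩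
        φ (u i) + load φ k + load φ j     ∎))

    clique-solvable-via-ui : ∀ ρ φ → φ (u i) ≤ 3 → load φ j ≤ 2 + m → load φ k ≤ 2 + m →
                             5 + (m + m) ≤ φ (u i) + (load φ j + load φ k) →
                             Solvable G φ (H i ρ)
    clique-solvable-via-ui ρ φ ui≤3 Hj≤2+m Hk≤2+m budget
      with ≤-<-connex (φ (u i)) 1 | ≤-<-connex (load φ k) m
    ... | inj₂ 1<ui | inj₂ m<Hk =
      let (y , y-heavy) = pigeonhole (copy φ k) m<Hk
      in solvable-via-common-neighbour (u i) (H k y) (u j) (λ ()) i≢j k≢j j≢i 1<ui y-heavy
    ... | inj₂ _ | inj₁ Hk≤m =
      let (x , x-heavy) = pigeonhole (copy φ j) m<Hj
      in solvable-by-move (H j x) (u i) j≢i x-heavy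
           (solvable-from-distance-two (u i) (u j) i≢j j≢i (≤-move-target j≢i 3≤ui))
      where
      3≤ui : 3 ≤ φ (u i)
      3≤ui = +-cancel-bounded (+-mono-≤ Hj≤2+m Hk≤m) (begin
        2 + m + m + 3                     ≡⟨ solve (m ∷ []) ⟩
        5 + (m + m)                       ≤⟨ budget ⟩
        φ (u i) + (load φ j + load φ k)   ≡⟨ +-comm (φ (u i)) _ ⟩
        load φ j + load φ k + φ (u i)     ∎)
      m<Hj : suc m ≤ load φ j
      m<Hj = ≤-trans (n≤1+n (suc m)) (+-cancel-bounded (+-mono-≤ ui≤3 Hk≤m) (begin
        3 + m + (2 + m)                   ≡⟨ solve (m ∷ []) ⟩
        5 + (m + m)                       ≤⟨ budget ⟩
        φ (u i) + (load φ j + load φ k)   ≡⟨ x∙yz≈xz∙y (φ (u i)) _ _ ⟩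
        φ (u i) + load φ k + load φ j     ∎))
    ... | inj₁ ui≤1 | _ =
      let (x , x-heavy) = pigeonhole (copy φ j) m<Hj
          (y , y-heavy) = pigeonhole (copy φ k) m<Hk
      in solvable-by-move (H j x) (u i) j≢i x-heavy
           (solvable-via-common-neighbour (u i) (H k y) (u j) (λ ()) i≢j k≢j j≢i
              (≤-move-target j≢i 1≤ui)
              (≤-move-other (copies-disjoint k≢j) (λ ()) y-heavy))
      where
      1≤ui : 1 ≤ φ (u i)
      1≤ui = +-cancel-bounded (+-mono-≤ Hj≤2+m Hk≤2+m) (begin
        2 + m + (2 + m) + 1               ≡⟨ solve (m ∷ []) ⟩
        5 + (m + m)                       ≤⟨ budget ⟩
        φ (u i) + (load φ j + load φ k)   ≡⟨ +-comm (φ (u i)) _ ⟩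
        load φ j + load φ k + φ (u i)     ∎)
      m<Hj : suc m ≤ load φ j
      m<Hj = ≤-trans (n≤1+n (suc m)) (+-cancel-bounded (+-mono-≤ ui≤1 Hk≤2+m) (begin
        1 + (2 + m) + (2 + m)             ≡⟨ solve (m ∷ []) ⟩
        5 + (m + m)                       ≤⟨ budget ⟩
        φ (u i) + (load φ j + load φ k)   ≡⟨ x∙yz≈xz∙y (φ (u i)) _ _ ⟩
        φ (u i) + load φ k + load φ j     ∎))
      m<Hk : suc m ≤ load φ k
      m<Hk = ≤-trans (n≤1+n (suc m)) (+-cancel-bounded (+-mono-≤ ui≤1 Hj≤2+m) (begin
        1 + (2 + m) + (2 + m)             ≡⟨ solve (m ∷ []) ⟩
        5 + (m + m)                       ≤⟨ budget ⟩
        φ (u i) + (load φ j + load φ k)   ≡⟨ +-assoc (φ (u i)) _ _ ⟨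
        φ (u i) + load φ j + load φ k     ∎))

  data HubInvariant (i : Fin 3) (ψ : Config G) : Set where
    spread  : (∀ w → ψ w ≤ 1) → ψ (u i) ≤ 0 → HubInvariant i ψ
    stacked : (∀ a → ψ (u a) ≤ 0) → (∀ b h → b ≢ i → ψ (H b h) ≤ 1) →
              Surplus (copy ψ i) 1 → HubInvariant i ψ

  hub-invariant-from-copy :
    ∀ {i φ ψ x} v → Adj G (H i x) v → StepAt φ ψ (H i x) v →
    (∀ a → φ (u a) ≤ 0) → (∀ b h → b ≢ i → φ (H b h) ≤ 1) → Surplus (copy φ i) 1 →
    HubInvariant i ψ
  hub-invariant-from-copy {i} {ψ = ψ} (inj₁ a) i≢a st@(sent , _) empty light surplus =
    spread light′ (≤-trans (≤-off-target st (u i) (adj⇒≢ i≢a)) (empty i))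
    where
    light-i : ∀ h → ψ (H i h) ≤ 1
    light-i = light-of-surplus
      (proj₂ (surplus-send surplus sent (λ h _ → ≤-off-target st (H i h) λ ())))
    light′ : ∀ w → ψ w ≤ 1
    light′ (inj₁ a′) = ≤-trans (≤-after-step st (u a′)) (+-monoˡ-≤ 1 (empty a′))
    light′ (inj₂ (b , h)) with b ≟ᶠ i
    ... | yes refl = light-i h
    ... | no b≢i   = ≤-trans (≤-off-target st (H b h) λ ()) (light b h b≢i)
  hub-invariant-from-copy (inj₂ _) (refl , x≢y) st@(sent , received , _) empty light surplus =
    stacked (λ a → ≤-trans (≤-off-target st (u a) λ ()) (empty a))
            (λ b h b≢i → ≤-trans (≤-off-target st (H b h) (copies-disjoint b≢i))
                                 (light b h b≢i))
            (surplus-shift surplus sent received (x≢y ∘ sym)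
               (λ h h≢y → ≤-off-target st (H _ h) (h≢y ∘ H-injective)))

  hub-invariant-closed : ∀ i → StepClosed (HubInvariant i)
  hub-invariant-closed i (s , _ , _ , st) (spread light _) = contradiction (light s) (source-≰1 st)
  hub-invariant-closed i (inj₁ a , _ , _ , st) (stacked empty _ _) =
    contradiction (≤-trans (empty a) z≤n) (source-≰1 st)
  hub-invariant-closed i (inj₂ (b , x) , v , sv , st) (stacked empty light surplus)
    with b ≟ᶠ i
  ... | no b≢i   = contradiction (light b x b≢i) (source-≰1 st)
  ... | yes refl = hub-invariant-from-copy v sv st empty light surplus

  hub-invariant-empty : ∀ {i ψ} → HubInvariant i ψ → ψ (u i) ≤ 0
  hub-invariant-empty (spread _ empty)  = empty
  hub-invariant-empty {i} (stacked empty _ _) = empty i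

  spiked : Fin 3 → Fin m → ℕ → ℕ → Config G
  spiked i z cᵢ c (inj₁ _) = 0
  spiked i z cᵢ c (inj₂ (b , h)) with b ≟ᶠ i
  ... | yes _ = spike z cᵢ h
  ... | no _  = spike z c h

  spiked-own : ∀ i z cᵢ c h → spiked i z cᵢ c (H i h) ≡ spike z cᵢ h
  spiked-own i z cᵢ c h with i ≟ᶠ i
  ... | yes _   = refl
  ... | no i≢i = contradiction refl i≢i

  spiked-other : ∀ {i b} z cᵢ c h → b ≢ i → spiked i z cᵢ c (H b h) ≡ spike z c h
  spiked-other {i} {b} z cᵢ c h b≢i with b ≟ᶠ i
  ... | yes b≡i = contradiction b≡i b≢i
  ... | no _    = refl

  module Roots {i} (o : Others i) where
    open Others o
    open ≤-Reasoning

    size-by-parts : ∀ φ → size G φ ≡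
                    (φ (u i) + φ (u j) + φ (u k)) + (load φ i + load φ j + load φ k)
    size-by-parts φ =
      trans (size-⋆ φ) (cong₂ _+_ (∑-by-others (φ ∘ u)) (∑-by-others (load φ)))

    size-spiked : ∀ z cᵢ c → size G (spiked i z cᵢ c) + 3 ≡ (m + cᵢ) + (m + c) + (m + c)
    size-spiked z cᵢ c = begin-equality
      size G φ₀ + 3                              ≡⟨ cong (_+ 3) (size-by-parts φ₀) ⟩
      load φ₀ i + load φ₀ j + load φ₀ k + 3
        ≡⟨ regroup (load φ₀ i) (load φ₀ j) (load φ₀ k) ⟩
      (load φ₀ i + 1) + (load φ₀ j + 1) + (load φ₀ k + 1)
        ≡⟨ cong₂ _+_ (cong₂ _+_ (load-spiked i (spiked-own i z cᵢ c))
                                (load-spiked j (λ h → spiked-other z cᵢ c h j≢i)))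
                     (load-spiked k (λ h → spiked-other z cᵢ c h k≢i)) ⟩
      (m + cᵢ) + (m + c) + (m + c)               ∎
      where
      φ₀ = spiked i z cᵢ c
      regroup : ∀ a b c → a + b + c + 3 ≡ (a + 1) + (b + 1) + (c + 1)
      regroup = solve-∀
      load-spiked : ∀ b {d} → (∀ h → φ₀ (H b h) ≡ spike z d h) → load φ₀ b + 1 ≡ m + d
      load-spiked b {d} eq = trans (cong (_+ 1) (sum-cong-≗ eq)) (∑-spike z d)

    hub-solvable-via-own-copy : ∀ φ → φ (u j) ≤ 1 → φ (u k) ≤ 1 →
                                 3 + m ≤ φ (u j) + φ (u k) + load φ i → Solvable G φ (u i)
    hub-solvable-via-own-copy φ uj≤1 uk≤1 budget
      with ≤-<-connex (φ (u j)) 0 | ≤-<-connex (φ (u k)) 0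
    ... | inj₂ 0<uj | _ =
      let (x , x-heavy) = pigeonhole (copy φ i) (+-cancel-bounded (+-mono-≤ uj≤1 uk≤1) budget)
      in solvable-along-path (H i x) (u j) i≢j j≢i x-heavy 0<uj
    ... | _ | inj₂ 0<uk =
      let (x , x-heavy) = pigeonhole (copy φ i) (+-cancel-bounded (+-mono-≤ uj≤1 uk≤1) budget)
      in solvable-along-path (H i x) (u k) i≢k k≢i x-heavy 0<uk
    ... | inj₁ uj≤0 | inj₁ uk≤0 =
      solvable-through (H i) (u j) H-injective (λ _ → i≢j) j≢i
        (+-cancel-bounded (+-mono-≤ uj≤0 uk≤0) budget)

    hub-solvable : ∀ φ → size G φ ≡ 3 * m + 3 → Solvable G φ (u i)
    hub-solvable φ size≡
      with ≤-<-connex (φ (u i)) 0 | ≤-<-connex (φ (u j)) 1 | ≤-<-connex (φ (u k)) 1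
         | ≤-<-connex (load φ j) m | ≤-<-connex (load φ k) m
    ... | inj₂ 0<ui | _ | _ | _ | _ = solvable-occupied 0<ui
    ... | _ | inj₂ 1<uj | _ | _ | _ = solvable-from-neighbour (u j) j≢i 1<uj
    ... | _ | _ | inj₂ 1<uk | _ | _ = solvable-from-neighbour (u k) k≢i 1<uk
    ... | _ | _ | _ | inj₂ m<Hj | _ = solvable-from-neighbours (H j) (λ _ → j≢i) m<Hj
    ... | _ | _ | _ | _ | inj₂ m<Hk = solvable-from-neighbours (H k) (λ _ → k≢i) m<Hk
    ... | inj₁ ui≤0 | inj₁ uj≤1 | inj₁ uk≤1 | inj₁ Hj≤m | inj₁ Hk≤m =
      hub-solvable-via-own-copy φ uj≤1 uk≤1
        (+-cancel-bounded (+-mono-≤ ui≤0 (+-mono-≤ Hj≤m Hk≤m)) (begin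
          0 + (m + m) + (3 + m)                                ≡⟨ solve (m ∷ []) ⟩
          3 * m + 3                                            ≡⟨ size≡ ⟨
          size G φ                                             ≡⟨ size-by-parts φ ⟩
          φ (u i) + φ (u j) + φ (u k) + (load φ i + load φ j + load φ k)
            ≡⟨ regroup (φ (u i)) (φ (u j)) (φ (u k)) (load φ i) (load φ j) (load φ k) ⟩
          φ (u i) + (load φ j + load φ k) + (φ (u j) + φ (u k) + load φ i) ∎))
      where
      regroup : ∀ a b c x y z → a + b + c + (x + y + z) ≡ a + (y + z) + (b + c + x)
      regroup = solve-∀

    clique-budget : ∀ φ → size G φ ≡ 3 * m + 4 → load φ i < m →
                    5 + (m + m) ≤ (φ (u j) + φ (u k)) + (φ (u i) + (load φ j + load φ k))
    clique-budget φ size≡ Hi<m = +-cancelʳ-≤ m _ _ (begin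
      5 + (m + m) + m                                     ≡⟨ solve (m ∷ []) ⟩
      3 * m + 4 + 1                                       ≡⟨ cong (_+ 1) size≡ ⟨
      size G φ + 1                                        ≡⟨ cong (_+ 1) (size-by-parts φ) ⟩
      φ (u i) + φ (u j) + φ (u k) + (load φ i + load φ j + load φ k) + 1
        ≡⟨ regroup (φ (u i)) (φ (u j)) (φ (u k)) (load φ i) (load φ j) (load φ k) ⟩
      (φ (u j) + φ (u k)) + (φ (u i) + (load φ j + load φ k)) + suc (load φ i)
        ≤⟨ +-monoʳ-≤ _ Hi<m ⟩
      (φ (u j) + φ (u k)) + (φ (u i) + (load φ j + load φ k)) + m ∎)
      where
      regroup : ∀ a b c x y z → a + b + c + (x + y + z) + 1 ≡ (b + c) + (a + (y + z)) + suc x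
      regroup = solve-∀

    module Via        = CliqueSolvability o
    module SwappedVia = CliqueSolvability (swap o)

    clique-solvable : ∀ ρ φ → size G φ ≡ 3 * m + 4 → Solvable G φ (H i ρ)
    clique-solvable ρ φ size≡
      with ≤-<-connex (φ (H i ρ)) 0 | ≤-<-connex (φ (u j)) 1 | ≤-<-connex (φ (u k)) 1
         | ≤-<-connex m (load φ i) | ≤-<-connex (φ (u i)) 3
         | ≤-<-connex (load φ k) (2 + m) | ≤-<-connex (load φ j) (2 + m)
    ... | inj₂ 0<r | _ | _ | _ | _ | _ | _ = solvable-occupied 0<r
    ... | _ | inj₂ 1<uj | _ | _ | _ | _ | _ = solvable-from-neighbour (u j) j≢i 1<uj
    ... | _ | _ | inj₂ 1<uk | _ | _ | _ | _ = solvable-from-neighbour (u k) k≢i 1<uk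
    ... | inj₁ r≤0 | _ | _ | inj₁ m≤Hi | _ | _ | _ =
      solvable-from-neighbours-except (H i) ρ r≤0 (λ _ h≢ρ → refl , h≢ρ) m≤Hi
    ... | _ | _ | _ | _ | inj₂ 3<ui | _ | _ = solvable-from-distance-two (u i) (u j) i≢j j≢i 3<ui
    ... | _ | _ | _ | _ | _ | inj₂ 2+m<Hk | _ =
      solvable-through (H k) (u j) H-injective (λ _ → k≢j) j≢i 2+m<Hk
    ... | _ | _ | _ | _ | _ | _ | inj₂ 2+m<Hj =
      solvable-through (H j) (u k) H-injective (λ _ → j≢k) k≢i 2+m<Hj
    ... | inj₁ _ | inj₁ uj≤1 | inj₁ uk≤1 | inj₂ Hi<m | inj₁ ui≤3
        | inj₁ Hk≤2+m | inj₁ Hj≤2+m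
      with ≤-<-connex (φ (u j)) 0 | ≤-<-connex (φ (u k)) 0
    ... | inj₂ 0<uj | _ =
      Via.clique-solvable-via-uj ρ φ 0<uj Hj≤2+m
        (+-cancel-bounded (+-mono-≤ uj≤1 uk≤1) (clique-budget φ size≡ Hi<m))
    ... | _ | inj₂ 0<uk =
      SwappedVia.clique-solvable-via-uj ρ φ 0<uk Hk≤2+m
        (≤-trans (+-cancel-bounded (+-mono-≤ uj≤1 uk≤1) (clique-budget φ size≡ Hi<m))
                 (≤-reflexive (cong (φ (u i) +_) (+-comm (load φ j) (load φ k)))))
    ... | inj₁ uj≤0 | inj₁ uk≤0 =
      Via.clique-solvable-via-ui ρ φ ui≤3 Hj≤2+m Hk≤2+m
        (+-cancel-bounded (+-mono-≤ uj≤0 uk≤0) (clique-budget φ size≡ Hi<m))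

    hub-root : Fin m → IsRootedPebblingNumber G (u i) (3 * m + 3)
    hub-root z = subst (IsRootedPebblingNumber G (u i)) size₀+1≡
      (rooted-pebbling-number truncatable φ₀ unsolvable
         (λ φ size≡ → hub-solvable φ (trans size≡ size₀+1≡)))
      where
      φ₀ : Config G
      φ₀ = spiked i z 3 1
      size₀+1≡ : suc (size G φ₀) ≡ 3 * m + 3
      size₀+1≡ = +-cancelʳ-≡ 3 _ _ (trans (cong suc (size-spiked z 3 1)) (solve (m ∷ [])))
      below-φ₀ : ∀ {ψ} → ψ ≤ᶜ φ₀ → HubInvariant i ψ
      below-φ₀ ψ≤ = stacked (λ a → ψ≤ (u a))
        (λ b h b≢i → ≤-trans (ψ≤ (H b h)) (≤-trans (≤-reflexive (spiked-other z 3 1 h b≢i))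
                                                     (spike-≤ z h ≤-refl ≤-refl)))
        (surplus-under-spike z (λ h → ≤-trans (ψ≤ (H i h)) (≤-reflexive (spiked-own i z 3 1 h)))
                             ≤-refl)
      unsolvable : ∀ ψ → ψ ≤ᶜ φ₀ → ¬ Solvable G ψ (u i)
      unsolvable ψ ψ≤ = unsolvable-by-invariant (hub-invariant-closed i) hub-invariant-empty
                                                (below-φ₀ ψ≤)

    CliqueInvariant : Fin m → Config G → Set
    CliqueInvariant ρ ψ = Sparse ρ (copy ψ i) × Potential i j k ψ

    module Steps        = PotentialSteps o
    module SwappedSteps = PotentialSteps (swap o)

    potential-from-ui : ∀ {φ ψ v} → Adj G (u i) v → StepAt φ ψ (u i) v →
                        Potential i j k φ → Potential i j k ψ
    potential-from-ui {v = inj₁ a} i≢a st with cover a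
    ... | inj₁ refl        = contradiction refl i≢a
    ... | inj₂ (inj₁ refl) = Steps.potential-ui→uj st
    ... | inj₂ (inj₂ refl) = swap-potential ∘ SwappedSteps.potential-ui→uj st ∘ swap-potential
    potential-from-ui {v = inj₂ (b , _)} i≢b st with cover b
    ... | inj₁ refl        = contradiction refl i≢b
    ... | inj₂ (inj₁ refl) = Steps.potential-ui→Hj st
    ... | inj₂ (inj₂ refl) = swap-potential ∘ SwappedSteps.potential-ui→Hj st ∘ swap-potential

    clique-invariant-closed : ∀ ρ → StepClosed (CliqueInvariant ρ)
    clique-invariant-closed ρ (inj₁ a , v , sv , st) (sparse , p) with cover a
    ... | inj₁ refl =
      sparse-mono (λ h → ≤-off-target st (H i h) (hub-misses-own-copy sv h)) sparse ,
      potential-from-ui sv st p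
    ... | inj₂ (inj₁ refl) = contradiction (capped⇒≤1 (Potential.capped-j p)) (source-≰1 st)
    ... | inj₂ (inj₂ refl) = contradiction (capped⇒≤1 (Potential.capped-k p)) (source-≰1 st)
    clique-invariant-closed ρ (inj₂ (b , x) , v , sv , st) (sparse , p) with cover b
    ... | inj₁ refl = contradiction (sparse-light sparse x) (source-≰1 st)
    ... | inj₂ (inj₁ refl) =
      sparse-mono (λ h → ≤-off-target st (H i h) (copy-misses-other-copies j≢i sv h)) sparse ,
      Steps.potential-from-Hj sv st p
    ... | inj₂ (inj₂ refl) =
      sparse-mono (λ h → ≤-off-target st (H i h) (copy-misses-other-copies k≢i sv h)) sparse ,
      swap-potential (SwappedSteps.potential-from-Hj sv st (swap-potential p))

    clique-root : ∀ ρ → IsRootedPebblingNumber G (H i ρ) (3 * m + 4)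
    clique-root ρ = subst (IsRootedPebblingNumber G (H i ρ)) size₀+1≡
      (rooted-pebbling-number truncatable φ₀ unsolvable
         (λ φ size≡ → clique-solvable ρ φ (trans size≡ size₀+1≡)))
      where
      φ₀ : Config G
      φ₀ = spiked i ρ 0 3
      size₀+1≡ : suc (size G φ₀) ≡ 3 * m + 4
      size₀+1≡ = +-cancelʳ-≡ 3 _ _ (trans (cong suc (size-spiked ρ 0 3)) (solve (m ∷ [])))
      other-copy : ∀ {ψ b} → ψ ≤ᶜ φ₀ → b ≢ i → Surplus (copy ψ b) 1
      other-copy ψ≤ b≢i =
        surplus-under-spike ρ
          (λ h → ≤-trans (ψ≤ (H _ h)) (≤-reflexive (spiked-other ρ 0 3 h b≢i))) ≤-refl
      below-φ₀ : ∀ {ψ} → ψ ≤ᶜ φ₀ → CliqueInvariant ρ ψ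
      below-φ₀ ψ≤ =
        record
          { empty-at  = ≤-trans (ψ≤ (H i ρ))
                                (≤-reflexive (trans (spiked-own i ρ 0 3 ρ) (spike-at ρ 0)))
          ; light-off = λ h h≢ρ → ≤-trans (ψ≤ (H i h))
                                (≤-reflexive (trans (spiked-own i ρ 0 3 h) (spike-off 0 h≢ρ)))
          } ,
        record
          { tj = 1 ; tk = 1
          ; surplus-j = other-copy ψ≤ j≢i
          ; surplus-k = other-copy ψ≤ k≢i
          ; capped-j  = capped-mono (ψ≤ (u j)) ≤-refl (ψ≤ (u i)) ≤-refl (capped ≤-refl)
          ; capped-k  = capped-mono (ψ≤ (u k)) ≤-refl (ψ≤ (u i)) ≤-refl (capped ≤-refl)
          }
      unsolvable : ∀ ψ → ψ ≤ᶜ φ₀ → ¬ Solvable G ψ (H i ρ)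
      unsolvable ψ ψ≤ =
        unsolvable-by-invariant (clique-invariant-closed ρ) (Sparse.empty-at ∘ proj₁) (below-φ₀ ψ≤)

  pebbling-number : Fin m → IsPebblingNumber G (3 * m + 4)
  pebbling-number z = rooted-below , H 0F z , Roots.clique-root (others 0F) z
    where
    rooted-below : ∀ r → ∃[ q ] IsRootedPebblingNumber G r q × q ≤ 3 * m + 4
    rooted-below (inj₁ a)       =
      3 * m + 3 , Roots.hub-root (others a) z , +-monoʳ-≤ (3 * m) (n≤1+n 3)
    rooted-below (inj₂ (a , ρ)) =
      3 * m + 4 , Roots.clique-root (others a) ρ , ≤-refl

  order≡ : order G + 1 ≡ 3 * m + 4
  order≡ = trans (cong (_+ 1) order-⋆) (solve (m ∷ []))

mainTheorem7 : (m : ℕ) → 0 < m →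
    Class1 (K 3 ⋆ K m) × IsPebblingNumber (K 3 ⋆ K m) (3 * m + 4)
mainTheorem7 (suc n) _ = subst (IsPebblingNumber G) (sym order≡) π≡ , π≡
  where
  open TriangleCorona (suc n)
  π≡ : IsPebblingNumber G (3 * suc n + 4)
  π≡ = pebbling-number zero
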